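{- For every positive integer $n$ and every $i\in\{1,\dots,n\}$, $\frac{n-i+1}{2}\le \beta_i(n)\le n-i+1$.
   Context: For a positive integer $n$, $[n]=\{1,\dots,n\}$. For a set $D$ of integers and families $\mathcal{F},\mathcal{F}'$ of subsets of $[n]$, $\mathcal{F}'$ is called $D$-secting for $\mathcal{F}$ if for every $A\in\mathcal{F}$ there exists $A'\in\mathcal{F}'$ with $|A\cap A'|-|A\cap([n]\setminus A')|\in D$. $\beta_D(\mathcal{F})$ denotes the minimum cardinality of a $D$-secting family for $\mathcal{F}$, and $\beta_i(\mathcal{F})=\beta_D(\mathcal{F})$ for $D=\{i\}$. Since $|A\cap A'|-|A\cap([n]\setminus A')|$ has the parity of $|A|$ and absolute value at most $|A|$, only sets $A$ with $|A|\equiv i \pmod 2$ and $|A|\ge i$ can be $\{i\}$-sected; accordingly $\beta_i(n)$ is the maximum of $\beta_i(\mathcal{F})$ over all families $\mathcal{F}$ of subsets $A\subseteq[n]$ with $|A|\equiv i\pmod 2$ and $|A|\ge i$. -}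

module Defs where

open import Data.Nat using (ℕ; _≤_; _%_)
open import Data.Integer using (ℤ; +_; _-_)
open import Data.Fin.Subset using (Subset; _∩_; ∁; ∣_∣)
open import Data.List using (List)
open import Data.List.Relation.Unary.All using (All)
open import Data.List.Relation.Unary.Any using (Any)
open import Data.Product using (_×_)
open import Relation.Binary.PropositionalEquality using (_≡_)

-- Subsets of [n] are represented by  Subset n  (characteristic vectors over Fin n).
-- Families of subsets are lists of subsets (cardinality = length for duplicate-free lists).

secval : {n : ℕ} → Subset n → Subset n → ℤ
secval A A' = (+ ∣ A ∩ A' ∣) - (+ ∣ A ∩ ∁ A' ∣)

Sects : {n : ℕ} → ℕ → Subset n → Subset n → Set
Sects i A A' = secval A A' ≡ + i

ISecting : {n : ℕ} → ℕ → List (Subset n) → List (Subset n) → Set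
ISecting i F F' = All (λ A → Any (λ A' → Sects i A A') F') F

Admissible : {n : ℕ} → ℕ → Subset n → Set
Admissible i A = (∣ A ∣ % 2 ≡ i % 2) × (i ≤ ∣ A ∣)

module Submission where

-- The n − i + 1 prefixes {1..i}, …, {1..n} form an i-secting family for every
-- admissible family: for admissible A the count |A ∩ {1..t}| climbs from 0 to |A| in unit steps,
-- so it hits h = (|A| + i)/2 at some t ≥ i, and then |A ∩ {1..t}| − |A ∖ {1..t}| = h − (|A| − h) = i.
--
-- Write i = k + 1, n = N + k and let F be the family of all
-- admissible sets; it contains b ∪ {N+1..N+k} for every odd-size b ⊆ [N].  Given an i-secting F'
-- with 2|F'| < N, the function P(b) = ∏_{A' ∈ F'} (secval (b ∪ {N+1..N+k}) A' − i) on the cube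
-- {0,1}ᴺ is a product of |F'| affine functions, vanishes at every odd b, yet P(∅) ≠ 0.  This
-- contradicts the key lemma  vanish-at-∅ : a function of degree ≤ m < N/2 vanishing at all odd
-- points vanishes at ∅, proved with the Walsh–Hadamard transform f̂ (orthogonality kills f̂(S)
-- for |S| > m, and f̂(S) = f̂(∁S) for such f, so f̂ ≡ 0 and f = 0).

open import Defs
open import Data.Nat using (ℕ; zero; suc; _≤_; _<_; z≤n; s≤s; _%_)
import Data.Nat as ℕ
import Data.Nat.Properties as ℕ
open import Data.Integer as ℤ using (ℤ; 0ℤ; 1ℤ; -1ℤ)
import Data.Integer.Properties as ℤ
open import Data.Fin.Subset using (Side; Subset; inside; outside; ∁; ∣_∣; _∩_) renaming (⊥ to ∅; ⊤ to full)
open import Data.Fin.Subset.Properties using (∣∁p∣≡n∸∣p∣; ∣p∩q∣≤∣p∣; ∣⊥∣≡0; ∣⊤∣≡n; ∩-zeroʳ)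
open import Data.Vec using ([]; _∷_; _++_)
open import Data.Product using (_×_; _,_; Σ)
open import Data.Sum using (_⊎_; inj₁; inj₂)
open import Data.List using (List; []; _∷_; length; map; filter; applyUpTo) renaming (_++_ to _++ˡ_)
open import Data.List.Properties using (length-applyUpTo)
open import Data.List.Relation.Unary.All as All using (All)
open import Data.List.Relation.Unary.All.Properties using (all-filter)
open import Data.List.Relation.Unary.Any as Any using (Any; here; there)
open import Data.List.Relation.Unary.Unique.Propositional using (Unique)
open import Data.List.Relation.Unary.Unique.Propositional.Properties using (applyUpTo⁺₁)
open import Data.List.Membership.Propositional using (_∈_; lose)
open import Data.List.Membership.Propositional.Properties using (∈-map⁺; ∈-++⁺ˡ; ∈-++⁺ʳ; ∈-filter⁺; ∈-applyUpTo⁺)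
open import Relation.Nullary using (Dec; yes; no; contradiction)
open import Relation.Nullary.Decidable using (_×-dec_)
open import Relation.Binary.PropositionalEquality
open ≡-Reasoning

module Cube where

  open import Data.Nat using (pred)
  open import Data.Integer using (+_; _+_; _-_; _*_; -_; _^_)
  open import Data.Integer.Tactic.RingSolver using (solve-∀)
  open import Data.Unit using (⊤)
  open import Function using (_∘_)

  Fn : ℕ → Set
  Fn N = Subset N → ℤ

  module _ {N : ℕ} where
    face₀ face₁ Δ : Fn (suc N) → Fn N
    face₀ f b = f (outside ∷ b)
    face₁ f b = f (inside ∷ b)
    Δ f b = face₁ f b - face₀ f b

  +-interchange : ∀ a b c d → (a + b) + (c + d) ≡ (a + c) + (b + d)
  +-interchange = solve-∀

  -+-interchange : ∀ a b c d → (a + b) - (c + d) ≡ (a - c) + (b - d)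
  -+-interchange = solve-∀

  -- "f has degree < d" as a multilinear polynomial, defined by finite differences: the facet
  -- x₁ = 0 has degree < d and Δf has degree < d − 1; on the 0-cube, degree < 0 means f = 0.
  Deg< : ∀ {N} → ℕ → Fn N → Set
  Deg< {zero}  zero    f = f [] ≡ 0ℤ
  Deg< {zero}  (suc d) f = ⊤
  Deg< {suc N} d       f = Deg< d (face₀ f) × Deg< (pred d) (Δ f)

  Deg<-cong : ∀ {N} d {f g : Fn N} → (∀ b → f b ≡ g b) → Deg< d f → Deg< d g
  Deg<-cong {zero}  zero    eq f[]≡0 = trans (sym (eq [])) f[]≡0
  Deg<-cong {zero}  (suc d) eq _     = _
  Deg<-cong {suc N} d       eq (D₀ , D₁) =
    Deg<-cong d (λ b → eq (outside ∷ b)) D₀ ,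
    Deg<-cong (pred d) (λ b → cong₂ _-_ (eq (inside ∷ b)) (eq (outside ∷ b))) D₁

  Deg<0⇒zero : ∀ {N} {f : Fn N} → Deg< 0 f → ∀ b → f b ≡ 0ℤ
  Deg<0⇒zero {zero}  f[]≡0      []            = f[]≡0
  Deg<0⇒zero {suc N} (D₀ , D₁) (outside ∷ b) = Deg<0⇒zero D₀ b
  Deg<0⇒zero {suc N} (D₀ , D₁) (inside ∷ b) =
    trans (ℤ.i-j≡0⇒i≡j _ _ (Deg<0⇒zero D₁ b)) (Deg<0⇒zero D₀ b)

  zero⇒Deg< : ∀ {N} d {f : Fn N} → (∀ b → f b ≡ 0ℤ) → Deg< d f
  zero⇒Deg< {zero}  zero    f≡0 = f≡0 []
  zero⇒Deg< {zero}  (suc d) f≡0 = _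
  zero⇒Deg< {suc N} d       f≡0 =
    zero⇒Deg< d (λ b → f≡0 (outside ∷ b)) ,
    zero⇒Deg< (pred d) (λ b → cong₂ _-_ (f≡0 (inside ∷ b)) (f≡0 (outside ∷ b)))

  Deg<-mono : ∀ {N} d {f : Fn N} → Deg< d f → Deg< (suc d) f
  Deg<-mono {zero}  zero    _ = _
  Deg<-mono {zero}  (suc d) _ = _
  Deg<-mono {suc N} zero    (D₀ , D₁) = Deg<-mono 0 D₀ , D₁
  Deg<-mono {suc N} (suc d) (D₀ , D₁) = Deg<-mono (suc d) D₀ , Deg<-mono d D₁

  Deg<-+ : ∀ {N} d {f g : Fn N} → Deg< d f → Deg< d g → Deg< d (λ b → f b + g b)
  Deg<-+ {zero}  zero    f[]≡0 g[]≡0 = cong₂ _+_ f[]≡0 g[]≡0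
  Deg<-+ {zero}  (suc d) _ _ = _
  Deg<-+ {suc N} d {f} {g} (D₀ , D₁) (E₀ , E₁) =
    Deg<-+ d D₀ E₀ ,
    Deg<-cong (pred d) (λ b → sym (Δ-sum b)) (Deg<-+ (pred d) D₁ E₁)
    where
    Δ-sum : ∀ b → Δ (λ b → f b + g b) b ≡ Δ f b + Δ g b
    Δ-sum b = -+-interchange (f (inside ∷ b)) (g (inside ∷ b)) (f (outside ∷ b)) (g (outside ∷ b))

  *-distribˡ-- : ∀ c x y → c * x - c * y ≡ c * (x - y)
  *-distribˡ-- = solve-∀

  Deg<-scale : ∀ {N} d c {f : Fn N} → Deg< d f → Deg< d (λ b → c * f b)
  Deg<-scale {zero}  zero    c f[]≡0 = trans (cong (c *_) f[]≡0) (ℤ.*-zeroʳ c)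
  Deg<-scale {zero}  (suc d) c _ = _
  Deg<-scale {suc N} d c {f} (D₀ , D₁) =
    Deg<-scale d c D₀ ,
    Deg<-cong (pred d) (λ b → sym (*-distribˡ-- c (f (inside ∷ b)) (f (outside ∷ b))))
      (Deg<-scale (pred d) c D₁)

  Deg<-const : ∀ {N} c → Deg< {N} 1 (λ _ → c)
  Deg<-const {zero}  c = _
  Deg<-const {suc N} c = Deg<-const c , zero⇒Deg< 0 (λ _ → ℤ.+-inverseʳ c)

  -- Affine functions b ↦ w₀ + Σ wⱼ bⱼ, described by their constant slope along each coordinate.
  Affine : ∀ {N} → Fn N → Set
  Affine {zero}  a = ⊤
  Affine {suc N} a = Affine (face₀ a) × Σ ℤ λ w → ∀ b → face₁ a b ≡ w + face₀ a b

  +-slope : ∀ a w c → a ≡ w + c → ∀ t → a + t ≡ w + (c + t)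
  +-slope a w c a≡w+c t = trans (cong (_+ t) a≡w+c) (ℤ.+-assoc w c t)

  Affine-shift : ∀ {N} {a : Fn N} t → Affine a → Affine (λ b → a b + t)
  Affine-shift {zero}  t _ = _
  Affine-shift {suc N} t (A₀ , w , slope) = Affine-shift t A₀ , w , λ b → +-slope _ w _ (slope b) t

  -- Discrete product rule Δ(af) = a₀ Δf + (Δa) f₁ for an affine a with Δa = w, and f₁ = Δf + f₀.
  product-rule : ∀ w a₀ f₀ f₁ → (w + a₀) * f₁ - a₀ * f₀ ≡ a₀ * (f₁ - f₀) + w * f₁
  product-rule = solve-∀

  split-face₁ : ∀ f₀ f₁ → f₁ ≡ (f₁ - f₀) + f₀
  split-face₁ = solve-∀

  Deg<-mulAffine : ∀ {N} d {a f : Fn N} → Affine a → Deg< d f → Deg< (suc d) (λ b → a b * f b)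
  Deg<-mulAffine zero {a} _ F =
    zero⇒Deg< 1 (λ b → trans (cong (a b *_) (Deg<0⇒zero F b)) (ℤ.*-zeroʳ (a b)))
  Deg<-mulAffine {zero}  (suc d) _ _ = _
  Deg<-mulAffine {suc N} (suc d) {a} {f} (A₀ , w , slope) (F₀ , F₁) =
    Deg<-mulAffine (suc d) A₀ F₀ ,
    Deg<-cong (suc d) (λ b → sym (derivative b))
      (Deg<-+ (suc d) (Deg<-mulAffine d A₀ F₁) (Deg<-scale (suc d) w face₁-deg))
    where
    derivative : ∀ b → Δ (λ b → a b * f b) b ≡ face₀ a b * Δ f b + w * face₁ f b
    derivative b = trans (cong (λ x → x * face₁ f b - face₀ a b * face₀ f b) (slope b))
                         (product-rule w (face₀ a b) (face₀ f b) (face₁ f b))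
    face₁-deg : Deg< (suc d) (face₁ f)
    face₁-deg = Deg<-cong (suc d) (λ b → sym (split-face₁ (face₀ f b) (face₁ f b)))
                  (Deg<-+ (suc d) (Deg<-mono d F₁) F₀)

  prod : ∀ {N} {A : Set} → (A → Fn N) → List A → Fn N
  prod f []       b = 1ℤ
  prod f (x ∷ xs) b = f x b * prod f xs b

  Deg<-prod : ∀ {N} {A : Set} {f : A → Fn N} → (∀ x → Affine (f x)) →
              ∀ xs → Deg< (suc (length xs)) (prod f xs)
  Deg<-prod affine []       = Deg<-const 1ℤ
  Deg<-prod affine (x ∷ xs) = Deg<-mulAffine _ (affine x) (Deg<-prod affine xs)

  prod-zero : ∀ {N} {A : Set} {f : A → Fn N} {xs} b → Any (λ x → f x b ≡ 0ℤ) xs → prod f xs b ≡ 0ℤ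
  prod-zero {f = f} {x ∷ xs} b (here fxb≡0) = cong (_* prod f xs b) fxb≡0
  prod-zero {f = f} {x ∷ xs} b (there any0) = trans (cong (f x b *_) (prod-zero b any0)) (ℤ.*-zeroʳ (f x b))

  prod-nonzero : ∀ {N} {A : Set} {f : A → Fn N} b → (∀ x → f x b ≢ 0ℤ) → ∀ xs → prod f xs b ≢ 0ℤ
  prod-nonzero b f≢0 []       ()
  prod-nonzero b f≢0 (x ∷ xs) product≡0 with ℤ.i*j≡0⇒i≡0∨j≡0 _ product≡0
  ... | inj₁ fxb≡0  = f≢0 x fxb≡0
  ... | inj₂ rest≡0 = prod-nonzero b f≢0 xs rest≡0

  -- Walsh–Hadamard transform f̂(S) = Σ_b (−1)^|S ∩ b| f(b), computed facet by facet.
  fourier : ∀ {N} → Fn N → Subset N → ℤ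
  fourier {zero}  f []            = f []
  fourier {suc N} f (outside ∷ S) = fourier (face₀ f) S + fourier (face₁ f) S
  fourier {suc N} f (inside ∷ S)  = fourier (face₀ f) S - fourier (face₁ f) S

  -- The transform is additive (stated pointwise so that callers need no separate congruence step).
  fourier-additive : ∀ {N} (f g h : Fn N) → (∀ b → h b ≡ f b + g b) →
                     ∀ S → fourier h S ≡ fourier f S + fourier g S
  fourier-additive {zero} f g h eq [] = eq []
  fourier-additive {suc N} f g h eq (σ ∷ S) = on σ
    where
    f̂₀ ĝ₀ f̂₁ ĝ₁ : ℤ
    f̂₀ = fourier (face₀ f) S
    ĝ₀ = fourier (face₀ g) S
    f̂₁ = fourier (face₁ f) S
    ĝ₁ = fourier (face₁ g) S
    ih₀ : fourier (face₀ h) S ≡ f̂₀ + ĝ₀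
    ih₀ = fourier-additive (face₀ f) (face₀ g) (face₀ h) (λ b → eq (outside ∷ b)) S
    ih₁ : fourier (face₁ h) S ≡ f̂₁ + ĝ₁
    ih₁ = fourier-additive (face₁ f) (face₁ g) (face₁ h) (λ b → eq (inside ∷ b)) S
    on : ∀ σ → fourier h (σ ∷ S) ≡ fourier f (σ ∷ S) + fourier g (σ ∷ S)
    on outside = trans (cong₂ _+_ ih₀ ih₁) (+-interchange f̂₀ ĝ₀ f̂₁ ĝ₁)
    on inside  = trans (cong₂ _-_ ih₀ ih₁) (-+-interchange f̂₀ ĝ₀ f̂₁ ĝ₁)

  fourier-high : ∀ {N} d {f : Fn N} → Deg< d f → ∀ S → d ≤ ∣ S ∣ → fourier f S ≡ 0ℤ
  fourier-high {zero} zero f[]≡0 [] z≤n = f[]≡0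
  fourier-high {suc N} d {f} (D₀ , D₁) (σ ∷ S) d≤∣S∣ = on σ d≤∣S∣
    where
    f̂₀ f̂₁ Δ̂ : ℤ
    f̂₀ = fourier (face₀ f) S
    f̂₁ = fourier (face₁ f) S
    Δ̂  = fourier (Δ f) S
    f̂₁≡Δ̂+f̂₀ : f̂₁ ≡ Δ̂ + f̂₀
    f̂₁≡Δ̂+f̂₀ = fourier-additive (Δ f) (face₀ f) (face₁ f) (λ b → split-face₁ (face₀ f b) (face₁ f b)) S
    Δ̂≡0 : pred d ≤ ∣ S ∣ → Δ̂ ≡ 0ℤ
    Δ̂≡0 = fourier-high (pred d) D₁ S
    on : ∀ σ → d ≤ ∣ σ ∷ S ∣ → fourier f (σ ∷ S) ≡ 0ℤ
    on outside d≤∣S∣ = begin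
      f̂₀ + f̂₁           ≡⟨ cong (λ x → f̂₀ + x) f̂₁≡Δ̂+f̂₀ ⟩
      f̂₀ + (Δ̂ + f̂₀)     ≡⟨ cong₂ (λ x y → x + (y + x)) (fourier-high d D₀ S d≤∣S∣) (Δ̂≡0 (ℕ.≤-trans ℕ.pred[n]≤n d≤∣S∣)) ⟩
      0ℤ                ∎
    on inside d≤1+∣S∣ = begin
      f̂₀ - f̂₁           ≡⟨ cong (λ x → f̂₀ - x) f̂₁≡Δ̂+f̂₀ ⟩
      f̂₀ - (Δ̂ + f̂₀)     ≡⟨ cancel f̂₀ Δ̂ ⟩
      - Δ̂               ≡⟨ cong -_ (Δ̂≡0 (ℕ.pred-mono-≤ d≤1+∣S∣)) ⟩
      0ℤ                ∎
      where cancel : ∀ x y → x - (y + x) ≡ - y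
            cancel = solve-∀

  sum-diff≡0 : ∀ x y → x + y ≡ 0ℤ → x - y ≡ 0ℤ → x ≡ 0ℤ
  sum-diff≡0 x y sum≡0 diff≡0 with ℤ.i*j≡0⇒i≡0∨j≡0 (+ 2) twice≡0
    where
    double : ∀ x y → + 2 * x ≡ (x + y) + (x - y)
    double = solve-∀
    twice≡0 : + 2 * x ≡ 0ℤ
    twice≡0 = trans (double x y) (cong₂ _+_ sum≡0 diff≡0)
  ... | inj₁ ()
  ... | inj₂ x≡0 = x≡0

  fourier≡0⇒at-∅ : ∀ {N} {f : Fn N} → (∀ S → fourier f S ≡ 0ℤ) → f ∅ ≡ 0ℤ
  fourier≡0⇒at-∅ {zero}  f̂≡0 = f̂≡0 []
  fourier≡0⇒at-∅ {suc N} f̂≡0 =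
    fourier≡0⇒at-∅ (λ S → sum-diff≡0 _ _ (f̂≡0 (outside ∷ S)) (f̂≡0 (inside ∷ S)))

  odd-or-sign≡1 : ∀ r → r % 2 ≡ 1 ⊎ -1ℤ ^ r ≡ 1ℤ
  odd-or-sign≡1 zero          = inj₂ refl
  odd-or-sign≡1 (suc zero)    = inj₁ refl
  odd-or-sign≡1 (suc (suc r)) with odd-or-sign≡1 r
  ... | inj₁ odd    = inj₁ odd
  ... | inj₂ sign≡1 = inj₂ (trans (double-neg (-1ℤ ^ r)) sign≡1)
    where double-neg : ∀ s → -1ℤ * (-1ℤ * s) ≡ s
          double-neg = solve-∀

  -- Complementing S multiplies f̂(S) by the sign (-1)^r when f vanishes on all b with |b| + r odd,
  -- since (-1)^|∁S ∩ b| = (-1)^|b| (-1)^|S ∩ b|.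
  fourier-∁ : ∀ {N} r {f : Fn N} → (∀ b → (∣ b ∣ ℕ.+ r) % 2 ≡ 1 → f b ≡ 0ℤ) →
              ∀ S → fourier f (∁ S) ≡ (-1ℤ ^ r) * fourier f S
  fourier-∁ {zero} r {f} vanish [] with odd-or-sign≡1 r
  ... | inj₁ odd    rewrite vanish [] odd = sym (ℤ.*-zeroʳ (-1ℤ ^ r))
  ... | inj₂ sign≡1 = sym (trans (cong (_* f []) sign≡1) (ℤ.*-identityˡ (f [])))
  fourier-∁ {suc N} r {f} vanish (σ ∷ S) = on σ
    where
    s f̂₀ f̂₁ : ℤ
    s  = -1ℤ ^ r
    f̂₀ = fourier (face₀ f) S
    f̂₁ = fourier (face₁ f) S
    ih₀ : fourier (face₀ f) (∁ S) ≡ s * f̂₀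
    ih₀ = fourier-∁ r (λ b → vanish (outside ∷ b)) S
    ih₁ : fourier (face₁ f) (∁ S) ≡ (-1ℤ * s) * f̂₁
    ih₁ = fourier-∁ (suc r) (λ b odd → vanish (inside ∷ b) (trans (cong (_% 2) (sym (ℕ.+-suc ∣ b ∣ r))) odd)) S
    on : ∀ σ → fourier f (∁ (σ ∷ S)) ≡ s * fourier f (σ ∷ S)
    on outside = trans (cong₂ _-_ ih₀ ih₁) (factor-sign s f̂₀ f̂₁)
      where factor-sign : ∀ s x y → s * x - (-1ℤ * s) * y ≡ s * (x + y)
            factor-sign = solve-∀
    on inside = trans (cong₂ _+_ ih₀ ih₁) (factor-sign s f̂₀ f̂₁)
      where factor-sign : ∀ s x y → s * x + (-1ℤ * s) * y ≡ s * (x - y)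
            factor-sign = solve-∀

  large-or-co-large : ∀ {N} m → m ℕ.+ m < N → (S : Subset N) → suc m ≤ ∣ S ∣ ⊎ suc m ≤ ∣ ∁ S ∣
  large-or-co-large {N} m 2m<N S with suc m ℕ.≤? ∣ S ∣
  ... | yes large = inj₁ large
  ... | no  small = inj₂ (subst (suc m ≤_) (sym (∣∁p∣≡n∸∣p∣ S))
                      (ℕ.m+n≤o⇒m≤o∸n (suc m) (ℕ.≤-trans (ℕ.+-monoʳ-≤ (suc m) (ℕ.≤-pred (ℕ.≰⇒> small))) 2m<N)))

  -- Key lemma: a function of degree ≤ m on the N-cube, 2m < N, that vanishes on every odd-size
  -- subset also vanishes at ∅.  (Its transform vanishes on large S by orthogonality, and on
  -- small S because f̂(S) = f̂(∁S) by the parity symmetry.)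
  vanish-at-∅ : ∀ {N} m {f : Fn N} → Deg< (suc m) f → m ℕ.+ m < N →
                (∀ b → ∣ b ∣ % 2 ≡ 1 → f b ≡ 0ℤ) → f ∅ ≡ 0ℤ
  vanish-at-∅ m {f} D 2m<N vanish = fourier≡0⇒at-∅ f̂≡0
    where
    f̂≡0 : ∀ S → fourier f S ≡ 0ℤ
    f̂≡0 S with large-or-co-large m 2m<N S
    ... | inj₁ large    = fourier-high (suc m) D S large
    ... | inj₂ co-large = begin
      fourier f S           ≡⟨ ℤ.*-identityˡ (fourier f S) ⟨
      1ℤ * fourier f S      ≡⟨ fourier-∁ 0 vanish′ S ⟨
      fourier f (∁ S)       ≡⟨ fourier-high (suc m) D (∁ S) co-large ⟩
      0ℤ                    ∎
      where vanish′ : ∀ b → (∣ b ∣ ℕ.+ 0) % 2 ≡ 1 → f b ≡ 0ℤ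
            vanish′ b = vanish b ∘ subst (λ x → x % 2 ≡ 1) (ℕ.+-identityʳ ∣ b ∣)

open Cube

open import Data.Nat using (_+_; _*_; _∸_; _/_)
open import Data.Nat.DivMod using (m≡m%n+[m/n]*n; %-distribˡ-+)
open import Data.Nat.Tactic.RingSolver using () renaming (solve-∀ to ℕ-solve)
open import Data.Integer.Tactic.RingSolver using () renaming (solve-∀ to ℤ-solve)

-- How secval changes when a new first element is added to the sected set:
-- +1 if it lies in the secting set, -1 otherwise.
slope : Side → ℤ
slope inside  = 1ℤ
slope outside = -1ℤ

secval-slope : ∀ {n} x (a A : Subset n) → secval (inside ∷ a) (x ∷ A) ≡ slope x ℤ.+ secval a A
secval-slope inside  a A = ℤ.+-assoc 1ℤ (ℤ.+ ∣ a ∩ A ∣) (ℤ.- ℤ.+ ∣ a ∩ ∁ A ∣)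
secval-slope outside a A = shift (ℤ.+ ∣ a ∩ A ∣) (ℤ.+ ∣ a ∩ ∁ A ∣)
  where shift : ∀ p q → p ℤ.- (1ℤ ℤ.+ q) ≡ -1ℤ ℤ.+ (p ℤ.- q)
        shift = ℤ-solve

secval-affine : ∀ {N k} (t : Subset k) (A' : Subset (N + k)) → Affine (λ b → secval (b ++ t) A')
secval-affine {zero}  t A'       = _
secval-affine {suc N} t (x ∷ A') = secval-affine t A' , slope x , λ b → secval-slope x (b ++ t) A'

secval≤ : ∀ {n} (A A' : Subset n) → secval A A' ℤ.≤ ℤ.+ ∣ A ∣
secval≤ A A' = ℤ.i≤j⇒i-k≤j (ℤ.+ ∣ A ∩ ∁ A' ∣) (ℤ.+≤+ (∣p∩q∣≤∣p∣ A A'))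

subsets : ∀ n → List (Subset n)
subsets zero    = [] ∷ []
subsets (suc n) = map (outside ∷_) (subsets n) ++ˡ map (inside ∷_) (subsets n)

∈-subsets : ∀ {n} (A : Subset n) → A ∈ subsets n
∈-subsets []                    = here refl
∈-subsets {suc n} (outside ∷ A) = ∈-++⁺ˡ (∈-map⁺ (outside ∷_) (∈-subsets A))
∈-subsets {suc n} (inside  ∷ A) = ∈-++⁺ʳ (map (outside ∷_) (subsets n)) (∈-map⁺ (inside ∷_) (∈-subsets A))

admissible? : ∀ {n} i (A : Subset n) → Dec (Admissible i A)
admissible? i A = (∣ A ∣ % 2 ℕ.≟ i % 2) ×-dec (i ℕ.≤? ∣ A ∣)

admissibleSets : ∀ n i → List (Subset n)
admissibleSets n i = filter (admissible? i) (subsets n)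

module LowerBound (N k : ℕ) where

  embed : Subset N → Subset (N + k)
  embed b = b ++ full

  ∣embed∣ : ∀ {m} (b : Subset m) → ∣ b ++ full {k} ∣ ≡ ∣ b ∣ + k
  ∣embed∣ []            = ∣⊤∣≡n k
  ∣embed∣ (outside ∷ b) = ∣embed∣ b
  ∣embed∣ (inside  ∷ b) = cong suc (∣embed∣ b)

  embed-admissible : ∀ b → ∣ b ∣ % 2 ≡ 1 → Admissible (suc k) (embed b)
  embed-admissible b odd = parity , size
    where
    parity : ∣ embed b ∣ % 2 ≡ suc k % 2
    parity = begin
      ∣ embed b ∣ % 2                ≡⟨ cong (_% 2) (∣embed∣ b) ⟩
      (∣ b ∣ + k) % 2                ≡⟨ %-distribˡ-+ ∣ b ∣ k 2 ⟩
      (∣ b ∣ % 2 + k % 2) % 2        ≡⟨ cong (λ r → (r + k % 2) % 2) odd ⟩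
      (1 + k % 2) % 2                ≡⟨ %-distribˡ-+ 1 k 2 ⟨
      suc k % 2                      ∎
    nonempty : ∀ m → m % 2 ≡ 1 → 1 ≤ m
    nonempty (suc m) _ = s≤s z≤n
    size : suc k ≤ ∣ embed b ∣
    size = subst (suc k ≤_) (sym (∣embed∣ b)) (ℕ.+-monoˡ-≤ k (nonempty ∣ b ∣ odd))

  target : ℤ
  target = ℤ.+ suc k

  factor : Subset (N + k) → Fn N
  factor A' b = secval (embed b) A' ℤ.- target

  factor-affine : ∀ A' → Affine (factor A')
  factor-affine A' = Affine-shift (ℤ.- target) (secval-affine full A')

  factor-zero : ∀ b A' → Sects (suc k) (embed b) A' → factor A' b ≡ 0ℤ
  factor-zero b A' sects = trans (cong (ℤ._- target) sects) (ℤ.+-inverseʳ target)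

  -- at b = ∅ the embedded set has only k elements, too few to be (k+1)-sected
  factor-nonzero-at-∅ : ∀ A' → factor A' ∅ ≢ 0ℤ
  factor-nonzero-at-∅ A' factor≡0 =
    ℕ.<-irrefl {k} refl (ℤ.drop‿+≤+ (subst (ℤ._≤ ℤ.+ k) secval≡target bounded))
    where
    secval≡target : secval (embed ∅) A' ≡ target
    secval≡target = ℤ.i-j≡0⇒i≡j _ _ factor≡0
    bounded : secval (embed ∅) A' ℤ.≤ ℤ.+ k
    bounded = subst (λ m → secval (embed ∅) A' ℤ.≤ ℤ.+ m)
                    (trans (∣embed∣ (∅ {N})) (cong (_+ k) (∣⊥∣≡0 N))) (secval≤ (embed ∅) A')

  -- If 2|F'| < N, then P = prod factor F' would contradict vanish-at-∅.
  lower-bound : (F' : List (Subset (N + k))) → ISecting (suc k) (admissibleSets (N + k) (suc k)) F' →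
                N ≤ 2 * length F'
  lower-bound F' sects with N ℕ.≤? 2 * length F'
  ... | yes N≤2m = N≤2m
  ... | no  N≰2m = contradiction (vanish-at-∅ m (Deg<-prod factor-affine F') 2m<N vanish-at-odd)
                                 (prod-nonzero ∅ factor-nonzero-at-∅ F')
    where
    m : ℕ
    m = length F'
    2m<N : m + m < N
    2m<N = subst (λ x → m + x < N) (ℕ.+-identityʳ m) (ℕ.≰⇒> N≰2m)
    vanish-at-odd : ∀ b → ∣ b ∣ % 2 ≡ 1 → prod factor F' b ≡ 0ℤ
    vanish-at-odd b odd = prod-zero b (Any.map (factor-zero b _) (All.lookup sects embed-b∈F))
      where embed-b∈F : embed b ∈ admissibleSets (N + k) (suc k)
            embed-b∈F = ∈-filter⁺ (admissible? (suc k)) (∈-subsets (embed b)) (embed-admissible b odd)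

-- The initial segment {1, …, t} of [n] (all of [n] once t ≥ n).
prefix : ∀ n → ℕ → Subset n
prefix zero    t       = []
prefix (suc n) zero    = ∅
prefix (suc n) (suc t) = inside ∷ prefix n t

∣prefix∣ : ∀ {n t} → t ≤ n → ∣ prefix n t ∣ ≡ t
∣prefix∣ {zero}  z≤n       = refl
∣prefix∣ {suc n} z≤n       = ∣⊥∣≡0 (suc n)
∣prefix∣ {suc n} (s≤s t≤n) = cong suc (∣prefix∣ t≤n)

-- Discrete intermediate value property: as t grows, |A ∩ {1..t}| takes every value h ≤ |A|
-- (and it can only reach h once t ≥ h).
prefix-hits : ∀ {n} (A : Subset n) h → h ≤ ∣ A ∣ → Σ ℕ λ t → h ≤ t × t ≤ n × ∣ A ∩ prefix n t ∣ ≡ h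
prefix-hits [] zero z≤n = 0 , z≤n , z≤n , refl
prefix-hits {suc n} (x ∷ A) zero _ = 0 , z≤n , z≤n , trans (cong ∣_∣ (∩-zeroʳ (x ∷ A))) (∣⊥∣≡0 (suc n))
prefix-hits (inside ∷ A)  (suc h) (s≤s h≤∣A∣) with prefix-hits A h h≤∣A∣
... | t , h≤t , t≤n , hit = suc t , s≤s h≤t , s≤s t≤n , cong suc hit
prefix-hits (outside ∷ A) (suc h) h≤∣A∣ with prefix-hits A (suc h) h≤∣A∣
... | t , h≤t , t≤n , hit = suc t , ℕ.m≤n⇒m≤1+n h≤t , s≤s t≤n , hit

∩-split : ∀ {n} (A p : Subset n) → ∣ A ∩ p ∣ + ∣ A ∩ ∁ p ∣ ≡ ∣ A ∣
∩-split []            []            = refl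
∩-split (outside ∷ A) (x ∷ p)       = ∩-split A p
∩-split (inside ∷ A)  (inside ∷ p)  = cong suc (∩-split A p)
∩-split (inside ∷ A)  (outside ∷ p) = trans (ℕ.+-suc _ _) (cong suc (∩-split A p))

midpoint : ∀ w i → w % 2 ≡ i % 2 → i ≤ w → Σ ℕ λ h → i ≤ h × h ≤ w × h + h ≡ w + i
midpoint w i same-parity i≤w = h , i≤h , h≤w , h+h≡w+i
  where
  h : ℕ
  h = w % 2 + w / 2 + i / 2
  h+h≡w+i : h + h ≡ w + i
  h+h≡w+i = begin
    h + h                                        ≡⟨ regroup (w % 2) (w / 2) (i / 2) ⟩
    (w % 2 + w / 2 * 2) + (w % 2 + i / 2 * 2)    ≡⟨ cong (λ r → (w % 2 + w / 2 * 2) + (r + i / 2 * 2)) same-parity ⟩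
    (w % 2 + w / 2 * 2) + (i % 2 + i / 2 * 2)    ≡⟨ cong₂ _+_ (m≡m%n+[m/n]*n w 2) (m≡m%n+[m/n]*n i 2) ⟨
    w + i                                        ∎
    where regroup : ∀ r p q → (r + p + q) + (r + p + q) ≡ (r + p * 2) + (r + q * 2)
          regroup = ℕ-solve
  i≤h : i ≤ h
  i≤h = ℕ.≮⇒≥ λ h<i → ℕ.<-irrefl h+h≡w+i (ℕ.<-≤-trans (ℕ.+-mono-< h<i h<i) (ℕ.+-monoˡ-≤ i i≤w))
  h≤w : h ≤ w
  h≤w = ℕ.≮⇒≥ λ w<h → ℕ.<-irrefl (sym h+h≡w+i) (ℕ.≤-<-trans (ℕ.+-monoʳ-≤ w i≤w) (ℕ.+-mono-< w<h w<h))

-- Every admissible A is i-sected by some prefix {1..t} with i ≤ t ≤ n: choose t with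
-- |A ∩ {1..t}| = (|A| + i)/2, so that |A ∖ {1..t}| = (|A| − i)/2.
prefix-sects : ∀ {n} i (A : Subset n) → Admissible i A → Σ ℕ λ t → i ≤ t × t ≤ n × Sects i A (prefix n t)
prefix-sects {n} i A (same-parity , i≤∣A∣) with midpoint ∣ A ∣ i same-parity i≤∣A∣
... | h , i≤h , h≤∣A∣ , h+h≡∣A∣+i with prefix-hits A h h≤∣A∣
...   | t , h≤t , t≤n , hit = t , ℕ.≤-trans i≤h h≤t , t≤n , sects
  where
  rest : ℕ
  rest = ∣ A ∩ ∁ (prefix n t) ∣
  h≡rest+i : h ≡ rest + i
  h≡rest+i = ℕ.+-cancelˡ-≡ h h (rest + i) (begin
    h + h                          ≡⟨ h+h≡∣A∣+i ⟩
    ∣ A ∣ + i                       ≡⟨ cong (_+ i) (∩-split A (prefix n t)) ⟨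
    ∣ A ∩ prefix n t ∣ + rest + i   ≡⟨ cong (λ x → x + rest + i) hit ⟩
    h + rest + i                   ≡⟨ ℕ.+-assoc h rest i ⟩
    h + (rest + i)                 ∎)
  sects : Sects i A (prefix n t)
  sects = begin
    ℤ.+ ∣ A ∩ prefix n t ∣ ℤ.- ℤ.+ rest   ≡⟨ cong (λ x → ℤ.+ x ℤ.- ℤ.+ rest) (trans hit h≡rest+i) ⟩
    ℤ.+ (rest + i) ℤ.- ℤ.+ rest           ≡⟨ cong (ℤ._- ℤ.+ rest) (ℤ.pos-+ rest i) ⟩
    (ℤ.+ rest ℤ.+ ℤ.+ i) ℤ.- ℤ.+ rest     ≡⟨ cancel (ℤ.+ rest) (ℤ.+ i) ⟩
    ℤ.+ i                                 ∎
    where cancel : ∀ a b → (a ℤ.+ b) ℤ.- a ≡ b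
          cancel = ℤ-solve

prefixes : ∀ n i → List (Subset n)
prefixes n i = applyUpTo (λ j → prefix n (i + j)) (n ∸ i + 1)

offset≤ : ∀ {n i j} → i ≤ n → j < n ∸ i + 1 → i + j ≤ n
offset≤ {n} {i} {j} i≤n j<count =
  ℕ.≤-trans (ℕ.+-monoʳ-≤ i (ℕ.≤-pred (subst (suc j ≤_) (ℕ.+-comm (n ∸ i) 1) j<count)))
            (ℕ.≤-reflexive (ℕ.m+[n∸m]≡n i≤n))

-- The prefixes are pairwise distinct, as their sizes i + j are.
prefixes-unique : ∀ n i → i ≤ n → Unique (prefixes n i)
prefixes-unique n i i≤n = applyUpTo⁺₁ _ (n ∸ i + 1) distinct
  where
  distinct : ∀ {j j'} → j < j' → j' < n ∸ i + 1 → prefix n (i + j) ≢ prefix n (i + j')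
  distinct {j} {j'} j<j' j'<count same = ℕ.<⇒≢ j<j' (ℕ.+-cancelˡ-≡ i j j' (begin
    i + j                   ≡⟨ ∣prefix∣ (offset≤ i≤n (ℕ.<-trans j<j' j'<count)) ⟨
    ∣ prefix n (i + j) ∣     ≡⟨ cong ∣_∣ same ⟩
    ∣ prefix n (i + j') ∣    ≡⟨ ∣prefix∣ (offset≤ i≤n j'<count) ⟩
    i + j'                  ∎))

∈-prefixes : ∀ {n i t} → i ≤ t → t ≤ n → prefix n t ∈ prefixes n i
∈-prefixes {n} {i} {t} i≤t t≤n =
  subst (λ s → prefix n s ∈ prefixes n i) (ℕ.m+[n∸m]≡n i≤t)
        (∈-applyUpTo⁺ (λ j → prefix n (i + j)) t∸i<count)
  where
  t∸i<count : t ∸ i < n ∸ i + 1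
  t∸i<count = subst (t ∸ i <_) (ℕ.+-comm 1 (n ∸ i)) (s≤s (ℕ.∸-monoˡ-≤ i t≤n))

upper-bound : ∀ n i → i ≤ n → (F : List (Subset n)) → All (Admissible i) F →
              Σ (List (Subset n)) λ F' → Unique F' × ISecting i F F' × length F' ≤ n ∸ i + 1
upper-bound n i i≤n F admissible =
  prefixes n i , prefixes-unique n i i≤n , All.map (λ {A} → sected A) admissible ,
  ℕ.≤-reflexive (length-applyUpTo (λ j → prefix n (i + j)) (n ∸ i + 1))
  where
  sected : ∀ A → Admissible i A → Any (Sects i A) (prefixes n i)
  sected A adm = sected-by-prefix (prefix-sects i A adm)
    where
    sected-by-prefix : (Σ ℕ λ t → i ≤ t × t ≤ n × Sects i A (prefix n t)) → Any (Sects i A) (prefixes n i)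
    sected-by-prefix (t , i≤t , t≤n , sects) = lose (∈-prefixes i≤t t≤n) sects

-- The lower bound for the family of all admissible sets, transported from n = (n − k) + k
-- back to n; the bound n − k equals n − i + 1 for i = k + 1.
admissibleSets-lower-bound : ∀ n k → suc k ≤ n → (F' : List (Subset n)) →
                             ISecting (suc k) (admissibleSets n (suc k)) F' → n ∸ suc k + 1 ≤ 2 * length F'
admissibleSets-lower-bound n k i≤n F' sects =
  subst (_≤ 2 * length F') (sym count≡n∸k) (lower-bound-at-n F' sects)
  where
  Bound : ℕ → Set
  Bound m = (F' : List (Subset m)) → ISecting (suc k) (admissibleSets m (suc k)) F' → n ∸ k ≤ 2 * length F'
  lower-bound-at-n : Bound n
  lower-bound-at-n = subst Bound (ℕ.m∸n+n≡m (ℕ.<⇒≤ i≤n)) (LowerBound.lower-bound (n ∸ k) k)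
  count≡n∸k : n ∸ suc k + 1 ≡ n ∸ k
  count≡n∸k = trans (ℕ.+-comm (n ∸ suc k) 1) (sym (ℕ.+-∸-assoc 1 i≤n))

theorem3 : (n i : ℕ) → 1 ≤ i → i ≤ n →
    (Σ (List (Subset n)) λ F → All (Admissible i) F ×
      ((F' : List (Subset n)) → Unique F' → ISecting i F F' → n ∸ i + 1 ≤ 2 * length F'))
    ×
    ((F : List (Subset n)) → All (Admissible i) F →
      Σ (List (Subset n)) λ F' → Unique F' × ISecting i F F' × length F' ≤ n ∸ i + 1)
theorem3 n (suc k) _ i≤n =
  (admissibleSets n (suc k) , all-filter (admissible? (suc k)) (subsets n) ,
   λ F' _ sects → admissibleSets-lower-bound n k i≤n F' sects) ,
  upper-bound n (suc k) i≤n
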